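{- In each of the logics DmBL and DmBL$_\ast$, for all $\phi,\psi\in\mathcal{L}$: $\vdash\Box\neg\phi\rightarrow(\psi\times\phi)$. In particular $(\psi|\bot)\equiv\psi$.
   Context: Fix a set $\Theta$ of atomic propositions. The language $\mathcal{L}$ is the smallest set containing $\Theta$ and closed under the formation of $\neg\phi$, $\Box\phi$, $\phi\rightarrow\psi$ and the conditional $(\psi|\phi)$. Abbreviations: $\phi\vee\psi=\neg\phi\rightarrow\psi$, $\phi\wedge\psi=\neg(\neg\phi\vee\neg\psi)$, $\phi\leftrightarrow\psi=(\phi\rightarrow\psi)\wedge(\psi\rightarrow\phi)$, $\top=\theta_0\rightarrow\theta_0$ for a fixed $\theta_0\in\Theta$, $\bot=\neg\top$, $\Diamond\phi=\neg\Box\neg\phi$, and (logical independence) $\psi\times\phi=\Box\bigl((\psi|\phi)\leftrightarrow\psi\bigr)$. The theorems ($\vdash$) of DmBL are the smallest set containing all instances of the axiom schemes below and closed under modus ponens (from $\vdash\phi$ and $\vdash\phi\rightarrow\psi$ infer $\vdash\psi$) and necessitation m1 (from $\vdash\phi$ infer $\vdash\Box\phi$): c1 $\phi\rightarrow(\psi\rightarrow\phi)$; c2 $(\eta\rightarrow(\phi\rightarrow\psi))\rightarrow((\eta\rightarrow\phi)\rightarrow(\eta\rightarrow\psi))$; c3 $(\neg\phi\rightarrow\neg\psi)\rightarrow((\neg\phi\rightarrow\psi)\rightarrow\phi)$; m2 $\Box(\phi\rightarrow\psi)\rightarrow(\Box\phi\rightarrow\Box\psi)$; m3 $\Box\phi\rightarrow\phi$;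 b1 $\Box(\phi\rightarrow\psi)\rightarrow(\Box\neg\phi\vee\Box(\psi|\phi))$; b2 $((\psi\rightarrow\eta)|\phi)\rightarrow((\psi|\phi)\rightarrow(\eta|\phi))$; b3 $(\psi|\phi)\rightarrow(\phi\rightarrow\psi)$; b4 $\neg(\neg\psi|\phi)\leftrightarrow(\psi|\phi)$; b5 $(\psi\times\phi)\leftrightarrow(\phi\times\psi)$. The logic DmBL$_\ast$ is defined in the same way but with b5 replaced by the two schemes b5.weak.A $(\psi\times\neg\phi)\leftrightarrow(\psi\times\phi)$ and b5.weak.B $\Box(\psi\leftrightarrow\eta)\rightarrow\Box((\phi|\psi)\leftrightarrow(\phi|\eta))$. $\phi\equiv\psi$ means $\vdash\phi\leftrightarrow\psi$. -}

module Defs where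

open import Data.Product using (_×_)
open import Relation.Binary.PropositionalEquality using (_≡_)

data Form (Θ : Set) : Set where
  atom : Θ → Form Θ
  ¬'_  : Form Θ → Form Θ
  □_   : Form Θ → Form Θ
  _⇒_  : Form Θ → Form Θ → Form Θ
  _∣_  : Form Θ → Form Θ → Form Θ

infixr 20 _⇒_
infix 30 ¬'_ □_

module Abbrev {Θ : Set} (θ₀ : Θ) where
  _∨_ : Form Θ → Form Θ → Form Θ
  φ ∨ ψ = (¬' φ) ⇒ ψ
  _∧_ : Form Θ → Form Θ → Form Θ
  φ ∧ ψ = ¬' ((¬' φ) ∨ (¬' ψ))
  _⇔_ : Form Θ → Form Θ → Form Θ
  φ ⇔ ψ = (φ ⇒ ψ) ∧ (ψ ⇒ φ)
  ⊤' : Form Θ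
  ⊤' = atom θ₀ ⇒ atom θ₀
  ⊥' : Form Θ
  ⊥' = ¬' ⊤'
  ◇_ : Form Θ → Form Θ
  ◇ φ = ¬' (□ (¬' φ))
  _⊗_ : Form Θ → Form Θ → Form Θ
  ψ ⊗ φ = □ ((ψ ∣ φ) ⇔ ψ)

data Logic : Set where
  DmBL DmBL* : Logic

module Deriv {Θ : Set} (θ₀ : Θ) where
  open Abbrev θ₀

  data ⊢[_]_ (L : Logic) : Form Θ → Set where
    c1 : ∀ φ ψ → ⊢[ L ] (φ ⇒ (ψ ⇒ φ))
    c2 : ∀ η φ ψ → ⊢[ L ] ((η ⇒ (φ ⇒ ψ)) ⇒ ((η ⇒ φ) ⇒ (η ⇒ ψ)))
    c3 : ∀ φ ψ → ⊢[ L ] (((¬' φ) ⇒ (¬' ψ)) ⇒ (((¬' φ) ⇒ ψ) ⇒ φ))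
    m2 : ∀ φ ψ → ⊢[ L ] ((□ (φ ⇒ ψ)) ⇒ ((□ φ) ⇒ (□ ψ)))
    m3 : ∀ φ → ⊢[ L ] ((□ φ) ⇒ φ)
    b1 : ∀ φ ψ → ⊢[ L ] ((□ (φ ⇒ ψ)) ⇒ ((□ (¬' φ)) ∨ (□ (ψ ∣ φ))))
    b2 : ∀ φ ψ η → ⊢[ L ] (((ψ ⇒ η) ∣ φ) ⇒ ((ψ ∣ φ) ⇒ (η ∣ φ)))
    b3 : ∀ φ ψ → ⊢[ L ] ((ψ ∣ φ) ⇒ (φ ⇒ ψ))
    b4 : ∀ φ ψ → ⊢[ L ] ((¬' ((¬' ψ) ∣ φ)) ⇔ (ψ ∣ φ))
    b5 : L ≡ DmBL → ∀ φ ψ → ⊢[ L ] ((ψ ⊗ φ) ⇔ (φ ⊗ ψ))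
    b5wA : L ≡ DmBL* → ∀ φ ψ → ⊢[ L ] ((ψ ⊗ (¬' φ)) ⇔ (ψ ⊗ φ))
    b5wB : L ≡ DmBL* → ∀ φ ψ η →
           ⊢[ L ] ((□ (ψ ⇔ η)) ⇒ (□ ((φ ∣ ψ) ⇔ (φ ∣ η))))
    mp : ∀ {φ ψ} → ⊢[ L ] φ → ⊢[ L ] (φ ⇒ ψ) → ⊢[ L ] ψ
    nec : ∀ {φ} → ⊢[ L ] φ → ⊢[ L ] (□ φ)

module _ {Θ : Set} (θ₀ : Θ) where
  open Abbrev θ₀
  open Deriv θ₀

  NecNegImpliesIndep : Logic → Set
  NecNegImpliesIndep L = (φ ψ : Form Θ) → ⊢[ L ] ((□ (¬' φ)) ⇒ (ψ ⊗ φ))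

  CondBotEquiv : Logic → Set
  CondBotEquiv L = (ψ : Form Θ) → ⊢[ L ] ((ψ ∣ ⊥') ⇔ ψ)

{-# OPTIONS --safe #-}
module Submission where

-- Conditioning on a true antecedent is vacuous by b3 and b4, so □¬φ yields
-- □((ψ|¬φ) ↔ ψ), i.e. ψ × ¬φ, which in DmBL* is ψ × φ by b5.weak.A. In DmBL we
-- use the symmetry b5 instead. If ◇ψ, then b1 applied to □(ψ → ¬φ) gives
-- □(¬φ|ψ), and together with □¬φ this forces both (φ|ψ) and φ to be false,
-- i.e. φ × ψ. If □¬ψ, then ◇¬ψ, so likewise φ × ¬ψ, hence ¬ψ × φ, and b4 turns
-- this into ψ × φ. Finally □¬⊥ is a theorem, so taking φ = ⊥ and applying m3
-- gives (ψ|⊥) ↔ ψ.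

open import Defs
open import Data.List using (List; []; _∷_)
open import Data.List.Membership.Propositional using (_∈_)
open import Data.List.Relation.Unary.Any using (here; there)
open import Data.Product using (_×_; _,_)
open import Relation.Binary.PropositionalEquality using (_≡_; refl)

module Calculus {Θ : Set} (θ₀ : Θ) (L : Logic) where
  open Abbrev θ₀
  open Deriv θ₀

  private
    variable
      Γ : List (Form Θ)
      φ ψ χ : Form Θ

  infix 4 _⊢_

  data _⊢_ (Γ : List (Form Θ)) : Form Θ → Set where
    hyp : φ ∈ Γ → Γ ⊢ φ
    ax  : ⊢[ L ] φ → Γ ⊢ φ
    app : Γ ⊢ φ ⇒ ψ → Γ ⊢ φ → Γ ⊢ ψ

  hyp₀ : φ ∷ Γ ⊢ φ
  hyp₀ = hyp (here refl)

  weaken : Γ ⊢ φ → ψ ∷ Γ ⊢ φ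
  weaken (hyp p)   = hyp (there p)
  weaken (ax p)    = ax p
  weaken (app f a) = app (weaken f) (weaken a)

  ⇒-refl : ∀ φ → ⊢[ L ] φ ⇒ φ
  ⇒-refl φ = mp (c1 φ φ) (mp (c1 φ (φ ⇒ φ)) (c2 φ (φ ⇒ φ) φ))

  deduction : φ ∷ Γ ⊢ ψ → Γ ⊢ φ ⇒ ψ
  deduction (hyp (here refl)) = ax (⇒-refl _)
  deduction (hyp (there p))   = app (ax (c1 _ _)) (hyp p)
  deduction (ax p)            = app (ax (c1 _ _)) (ax p)
  deduction (app f a)         = app (app (ax (c2 _ _ _)) (deduction f)) (deduction a)

  closed : [] ⊢ φ → ⊢[ L ] φ
  closed (ax p)    = p
  closed (app f a) = mp (closed a) (closed f)

  □-map : (∀ {Δ} → Δ ⊢ φ → Δ ⊢ ψ) → Γ ⊢ □ φ → Γ ⊢ □ ψ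
  □-map r = app (ax (mp (nec (closed (deduction (r hyp₀)))) (m2 _ _)))

  □-map₂ : (∀ {Δ} → Δ ⊢ φ → Δ ⊢ ψ → Δ ⊢ χ) → Γ ⊢ □ φ → Γ ⊢ □ ψ → Γ ⊢ □ χ
  □-map₂ r a = app (app (ax (m2 _ _)) (□-map (λ p → deduction (r (weaken p) hyp₀)) a))

  explosion : Γ ⊢ ¬' φ → Γ ⊢ φ → Γ ⊢ ψ
  explosion {ψ = ψ} n p = app (app (ax (c3 ψ _)) (app (ax (c1 _ _)) n)) (app (ax (c1 _ _)) p)

  by-contradiction : ¬' φ ∷ Γ ⊢ ψ → ¬' φ ∷ Γ ⊢ ¬' ψ → Γ ⊢ φ
  by-contradiction p n = app (app (ax (c3 _ _)) (deduction n)) (deduction p)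

  ¬¬-elim : Γ ⊢ ¬' ¬' φ → Γ ⊢ φ
  ¬¬-elim n = by-contradiction hyp₀ (weaken n)

  ¬-intro : φ ∷ Γ ⊢ ψ → φ ∷ Γ ⊢ ¬' ψ → Γ ⊢ ¬' φ
  ¬-intro p n = by-contradiction (app (weaken (deduction p)) (¬¬-elim hyp₀))
                                 (app (weaken (deduction n)) (¬¬-elim hyp₀))

  ¬¬-intro : Γ ⊢ φ → Γ ⊢ ¬' ¬' φ
  ¬¬-intro p = ¬-intro (weaken p) hyp₀

  by-cases : φ ∷ Γ ⊢ χ → ¬' φ ∷ Γ ⊢ χ → Γ ⊢ χ
  by-cases p n = by-contradiction
    (app (weaken (deduction n)) (¬-intro (app (weaken (weaken (deduction p))) hyp₀) (weaken hyp₀)))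
    hyp₀

  ∧-intro : Γ ⊢ φ → Γ ⊢ ψ → Γ ⊢ φ ∧ ψ
  ∧-intro p q = ¬-intro (weaken q) (app hyp₀ (¬¬-intro (weaken p)))

  ∧-elim₁ : Γ ⊢ φ ∧ ψ → Γ ⊢ φ
  ∧-elim₁ c = by-contradiction (deduction (explosion hyp₀ (weaken hyp₀))) (weaken c)

  ∧-elim₂ : Γ ⊢ φ ∧ ψ → Γ ⊢ ψ
  ∧-elim₂ c = by-contradiction (app (ax (c1 _ _)) hyp₀) (weaken c)

  ⇔-intro : Γ ⊢ φ ⇒ ψ → Γ ⊢ ψ ⇒ φ → Γ ⊢ φ ⇔ ψ
  ⇔-intro = ∧-intro

  ⇔-to : Γ ⊢ φ ⇔ ψ → Γ ⊢ φ → Γ ⊢ ψ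
  ⇔-to c = app (∧-elim₁ c)

  ⇔-from : Γ ⊢ φ ⇔ ψ → Γ ⊢ ψ → Γ ⊢ φ
  ⇔-from c = app (∧-elim₂ c)

  ◇-of-□ : Γ ⊢ □ φ → Γ ⊢ ◇ φ
  ◇-of-□ b = ¬-intro (app (ax (m3 _)) (weaken b)) (app (ax (m3 _)) hyp₀)

  cond-elim : Γ ⊢ ψ ∣ χ → Γ ⊢ χ → Γ ⊢ ψ
  cond-elim c = app (app (ax (b3 _ _)) c)

  cond⇒¬cond¬ : Γ ⊢ ψ ∣ χ → Γ ⊢ ¬' (¬' ψ ∣ χ)
  cond⇒¬cond¬ = ⇔-from (ax (b4 _ _))

  ¬cond¬⇒cond : Γ ⊢ ¬' (¬' ψ ∣ χ) → Γ ⊢ ψ ∣ χ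
  ¬cond¬⇒cond = ⇔-to (ax (b4 _ _))

  cond⇔-of-antecedent : Γ ⊢ χ → Γ ⊢ (ψ ∣ χ) ⇔ ψ
  cond⇔-of-antecedent {χ = χ} {ψ = ψ} a = ⇔-intro
    (deduction (cond-elim hyp₀ (weaken a)))
    (deduction (by-cases {φ = ¬' ψ ∣ χ}
      (explosion (cond-elim hyp₀ (weaken (weaken a))) (weaken hyp₀))
      (¬cond¬⇒cond hyp₀)))

  cond⇔-of-cond¬-¬ : Γ ⊢ ¬' φ ∣ χ → Γ ⊢ ¬' φ → Γ ⊢ (φ ∣ χ) ⇔ φ
  cond⇔-of-cond¬-¬ c n = ⇔-intro
    (deduction (explosion (cond⇒¬cond¬ hyp₀) (weaken c)))
    (deduction (explosion (weaken n) hyp₀))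

  cond⇔-of-cond¬⇔ : Γ ⊢ (¬' ψ ∣ φ) ⇔ ¬' ψ → Γ ⊢ (ψ ∣ φ) ⇔ ψ
  cond⇔-of-cond¬⇔ {ψ = ψ} {φ = φ} e = ⇔-intro
    (deduction (by-contradiction {ψ = ¬' ψ ∣ φ}
      (⇔-from (weaken (weaken e)) hyp₀)
      (cond⇒¬cond¬ (weaken hyp₀))))
    (deduction (by-cases {φ = ¬' ψ ∣ φ}
      (explosion (⇔-to (weaken (weaken e)) hyp₀) (weaken hyp₀))
      (¬cond¬⇒cond hyp₀)))

  ⊗-of-¬⊗ : Γ ⊢ (¬' ψ) ⊗ φ → Γ ⊢ ψ ⊗ φ
  ⊗-of-¬⊗ = □-map cond⇔-of-cond¬⇔

  ⊗-of-□¬-◇ : Γ ⊢ □ ¬' φ → Γ ⊢ ◇ χ → Γ ⊢ φ ⊗ χ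
  ⊗-of-□¬-◇ {Γ = Γ} {φ = φ} {χ = χ} b d = □-map₂ cond⇔-of-cond¬-¬ □cond b
    where
    □cond : Γ ⊢ □ (¬' φ ∣ χ)
    □cond = app (app (ax (b1 χ (¬' φ))) (□-map (app (ax (c1 _ _))) b)) d

  ⊗-sym : L ≡ DmBL → Γ ⊢ ψ ⊗ φ → Γ ⊢ φ ⊗ ψ
  ⊗-sym e = ⇔-to (ax (b5 e _ _))

  ⊗-of-⊗¬ : L ≡ DmBL* → Γ ⊢ ψ ⊗ (¬' φ) → Γ ⊢ ψ ⊗ φ
  ⊗-of-⊗¬ e = ⇔-to (ax (b5wA e _ _))

  necNegImpliesIndep-DmBL : L ≡ DmBL → NecNegImpliesIndep θ₀ L
  necNegImpliesIndep-DmBL e φ ψ = closed (deduction (by-cases {φ = □ ¬' ψ}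
    (⊗-of-¬⊗ (⊗-sym e (⊗-of-□¬-◇ (weaken hyp₀) (◇-of-□ hyp₀))))
    (⊗-sym e (⊗-of-□¬-◇ (weaken hyp₀) hyp₀))))

  necNegImpliesIndep-DmBL* : L ≡ DmBL* → NecNegImpliesIndep θ₀ L
  necNegImpliesIndep-DmBL* e φ ψ =
    closed (deduction (⊗-of-⊗¬ e (□-map cond⇔-of-antecedent hyp₀)))

  condBotEquiv : NecNegImpliesIndep θ₀ L → CondBotEquiv θ₀ L
  condBotEquiv indep ψ = closed (app (ax (m3 _)) (app (ax (indep ⊥' ψ)) □¬⊥))
    where
    □¬⊥ : [] ⊢ □ ¬' ⊥'
    □¬⊥ = ax (nec (closed (¬¬-intro (ax (⇒-refl _)))))

necNegImpliesIndep : {Θ : Set} (θ₀ : Θ) (L : Logic) → NecNegImpliesIndep θ₀ L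
necNegImpliesIndep θ₀ DmBL  = Calculus.necNegImpliesIndep-DmBL θ₀ DmBL refl
necNegImpliesIndep θ₀ DmBL* = Calculus.necNegImpliesIndep-DmBL* θ₀ DmBL* refl

mainTheorem2 : {Θ : Set} (θ₀ : Θ) (L : Logic) →
    NecNegImpliesIndep θ₀ L × CondBotEquiv θ₀ L
mainTheorem2 θ₀ L = indep , Calculus.condBotEquiv θ₀ L indep
  where
  indep : NecNegImpliesIndep θ₀ L
  indep = necNegImpliesIndep θ₀ L
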